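{- Every independent module-composed graph is HHDG-free, i.e. contains no house, no hole, no domino and no gem as an induced subgraph.
   Context: All graphs are finite, simple and undirected. For a graph $G=(V_G,E_G)$ and $v\in V_G$, $N(v)=\{w\in V_G : \{v,w\}\in E_G\}$. A set $M\subseteq V_G$ is a module of $G$ if for all $v_1,v_2\in M$ we have $N(v_1)\setminus M=N(v_2)\setminus M$ (in particular the empty set, singletons and $V_G$ are modules). For $U\subseteq V_G$, $G[U]$ is the induced subgraph on $U$. A graph $G$ is independent module-composed if there is a bijection $\varphi:V_G\to\{1,\ldots,|V_G|\}$ such that for every $2\le i\le |V_G|$ the neighbourhood of $\varphi^{ -1}(i)$ in the graph $G[\{\varphi^{ -1}(1),\ldots,\varphi^{ -1}(i-1)\}]$ is a module of that graph which is an independent set. A hole is a chordless cycle on at least five vertices. The house is the complement of the path $P_5$. The domino is the graph on vertices $a_1,a_2,a_3,b_1,b_2,b_3$ with edges $a_1a_2,a_2a_3,b_1b_2,b_2b_3,a_1b_1,a_2b_2,a_3b_3$. The gem is the path $P_4$ together with one additional vertex adjacent to all four path vertices. -}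

module Defs where

open import Data.Nat using (ℕ; zero; suc; _+_; _<_; _≤_)
open import Data.Fin using (Fin; toℕ; zero; suc)
open import Data.Fin.Patterns
open import Data.Product using (Σ; _×_; _,_; ∃-syntax)
open import Data.Empty using (⊥)
open import Relation.Nullary using (¬_; Dec)
open import Relation.Binary.PropositionalEquality using (_≡_)
open import Function.Bundles using (_↔_; _⇔_)
open import Function.Definitions using (Injective)
open import Level using (0ℓ)
open import Data.Bool using (Bool; true; false; T; _∨_)
open import Data.Sum using (_⊎_)

record Graph (n : ℕ) : Set₁ where
  field
    Adj   : Fin n → Fin n → Set
    dec   : ∀ u v → Dec (Adj u v)
    sym   : ∀ {u v} → Adj u v → Adj v u
    irrefl : ∀ {u} → ¬ Adj u u
open Graph public

IsModuleIn : ∀ {n} → Graph n → (U M : Fin n → Set) → Set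
IsModuleIn G U M = ∀ v₁ v₂ → M v₁ → M v₂ →
  ∀ w → U w → ¬ M w → (Adj G v₁ w ⇔ Adj G v₂ w)

IsIndependent : ∀ {n} → Graph n → (M : Fin n → Set) → Set
IsIndependent G M = ∀ u v → M u → M v → ¬ Adj G u v

Earlier : ∀ {n} → (Fin n → Fin n) → Fin n → Fin n → Set
Earlier σ i w = ∃[ j ] (toℕ j < toℕ i × σ j ≡ w)

EarlierNbhd : ∀ {n} → Graph n → (Fin n → Fin n) → Fin n → Fin n → Set
EarlierNbhd G σ i w = Earlier σ i w × Adj G (σ i) w

-- Independent module-composed: there is a bijective ordering of the vertices
-- such that, for every position i (i ≥ 1; for i = 0 the condition is vacuous),
-- the neighbourhood of the i-th vertex among the earlier vertices is a module
-- of the graph induced on the earlier vertices and an independent set.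
IndependentModuleComposed : ∀ {n} → Graph n → Set
IndependentModuleComposed {n} G =
  Σ (Fin n ↔ Fin n) λ φ⁻¹ →
    let σ = Function.Bundles.Inverse.to φ⁻¹ in
    ∀ i → IsModuleIn G (Earlier σ i) (EarlierNbhd G σ i)
        × IsIndependent G (EarlierNbhd G σ i)

HasInduced : ∀ {n} k → (Fin k → Fin k → Set) → Graph n → Set
HasInduced {n} k R G =
  Σ (Fin k → Fin n) λ f → Injective _≡_ _≡_ f ×
    (∀ u v → R u v ⇔ Adj G (f u) (f v))

-- Symmetric closure of a boolean edge list (given in one direction).
SymAdj : ∀ {k} → (Fin k → Fin k → Bool) → Fin k → Fin k → Set
SymAdj e u v = T (e u v ∨ e v u)

CycleAdj : ∀ m → Fin m → Fin m → Set
CycleAdj m i j = (suc (toℕ i) ≡ toℕ j) ⊎ (suc (toℕ j) ≡ toℕ i)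
  ⊎ (toℕ i ≡ 0 × suc (toℕ j) ≡ m) ⊎ (toℕ j ≡ 0 × suc (toℕ i) ≡ m)

-- House = complement of P₅. Vertices 0..4: square 0-1-2-3-0, roof 4 adjacent to 0,1.
houseE : Fin 5 → Fin 5 → Bool
houseE 0F 1F = true
houseE 1F 2F = true
houseE 2F 3F = true
houseE 3F 0F = true
houseE 4F 0F = true
houseE 4F 1F = true
houseE _ _ = false

-- Domino: a₁=0,a₂=1,a₃=2,b₁=3,b₂=4,b₃=5.
dominoE : Fin 6 → Fin 6 → Bool
dominoE 0F 1F = true
dominoE 1F 2F = true
dominoE 3F 4F = true
dominoE 4F 5F = true
dominoE 0F 3F = true
dominoE 1F 4F = true
dominoE 2F 5F = true
dominoE _ _ = false

gemE : Fin 5 → Fin 5 → Bool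
gemE 0F 1F = true
gemE 1F 2F = true
gemE 2F 3F = true
gemE 4F 0F = true
gemE 4F 1F = true
gemE 4F 2F = true
gemE 4F 3F = true
gemE _ _ = false

HHDGFree : ∀ {n} → Graph n → Set
HHDGFree G =
    ¬ HasInduced 5 (SymAdj houseE) G
  × (∀ m → 5 ≤ m → ¬ HasInduced m (CycleAdj m) G)
  × ¬ HasInduced 6 (SymAdj dominoE) G
  × ¬ HasInduced 5 (SymAdj gemE) G

module Submission where

-- Let G be independent module-composed with vertex ordering σ and
-- suppose some pattern graph H on Fin (suc k) occurs in G as an induced copy.
-- Let x be the vertex of H whose image is placed last by σ; the images of all
-- other vertices of H come earlier.  Hence the H-neighbours of x are mapped into
-- the earlier neighbourhood N of the image of x, which must be an independent
-- module of the graph induced on the earlier vertices.  So H has no obstruction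
-- at x, where an obstruction is either
--   * a triangle: two adjacent neighbours of x (contradicting independence), or
--   * a split: neighbours a, b of x and a vertex w ∉ N[x] adjacent to a but not
--     to b (contradicting the module property, as w lies outside N).
-- A pattern with an obstruction at every vertex therefore never occurs
-- (obstructed-patterns-excluded).  House, domino and gem are obstructed at every
-- vertex by inspection; in a cycle C_m, m ≥ 5, the two neighbours of a vertex
-- are split by the vertex at distance two from it beyond one of them.

open import Defs hiding (sym)
open import Data.Nat using (ℕ; zero; suc; _+_; _≤_; _<_; s≤s; z<s; s<s)
open import Data.Nat.Properties
  using (≤∧≢⇒<; ≤-<-trans; m≤n⇒m<n∨m≡n; n<1+n; n≤1+n; m≤n+m; +-monoˡ-<)
open import Data.Fin using (Fin; toℕ; fromℕ<)
open import Data.Fin.Properties using (toℕ-injective; toℕ<n; toℕ-fromℕ<)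
open import Data.Fin.Patterns
open import Data.List using (allFin)
open import Data.List.Extrema.Nat using (argmax; f[xs]≤f[argmax])
open import Data.List.Membership.Propositional.Properties using (∈-allFin)
import Data.List.Relation.Unary.All as All
open import Data.Product using (_×_; _,_; proj₁; proj₂; Σ-syntax)
open import Data.Sum using (_⊎_; inj₁; inj₂)
open import Data.Empty using (⊥)
open import Data.Unit using (tt)
open import Relation.Nullary using (¬_)
open import Relation.Binary.PropositionalEquality
  using (_≡_; _≢_; refl; sym; trans; cong; subst; module ≡-Reasoning)
open import Function.Bundles using (_↔_; _⇔_; Inverse; Equivalence)
open import Function.Definitions using (Injective)

-- A local configuration around the vertex x of a pattern relation R that
-- prevents x from being the last vertex added in an independent
-- module-composed ordering.
data Obstruction {A : Set} (R : A → A → Set) (x : A) : Set where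
  triangle : ∀ a b → R x a → R x b → R a b → Obstruction R x
  split    : ∀ a b w → R x a → R x b → ¬ R x w → w ≢ x → R a w → ¬ R b w →
             Obstruction R x

lastVertex : ∀ {n k} (φ : Fin n ↔ Fin n) (f : Fin (suc k) → Fin n) →
  Injective _≡_ _≡_ f →
  Σ[ x ∈ Fin (suc k) ]
    (∀ y → y ≢ x → Earlier (Inverse.to φ) (Inverse.from φ (f x)) (f y))
lastVertex {k = k} φ f f-inj = x , earlier
  where
  open Inverse φ
  position : Fin (suc k) → ℕ
  position y = toℕ (from (f y))

  x : Fin (suc k)
  x = argmax position 0F (allFin (suc k))

  maximal : ∀ y → position y ≤ position x
  maximal y = All.lookup (f[xs]≤f[argmax] {f = position} 0F (allFin (suc k))) (∈-allFin y)

  positionsDiffer : ∀ y → y ≢ x → position y ≢ position x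
  positionsDiffer y y≢x same = y≢x (f-inj (begin
      f y               ≡⟨ sym (strictlyInverseˡ (f y)) ⟩
      to (from (f y))   ≡⟨ cong to (toℕ-injective same) ⟩
      to (from (f x))   ≡⟨ strictlyInverseˡ (f x) ⟩
      f x               ∎))
    where open ≡-Reasoning

  earlier : ∀ y → y ≢ x → Earlier to (from (f x)) (f y)
  earlier y y≢x =
    from (f y) , ≤∧≢⇒< (maximal y) (positionsDiffer y y≢x) , strictlyInverseˡ (f y)

obstructedPatternsExcluded : ∀ {n k} (G : Graph n) → IndependentModuleComposed G →
  (R : Fin (suc k) → Fin (suc k) → Set) → (∀ x → Obstruction R x) →
  ¬ HasInduced (suc k) R G
obstructedPatternsExcluded G (φ , composed) R obstructed (f , f-inj , f-iso)
  with lastVertex φ f f-inj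
... | x , earlier = refute (obstructed x)
  where
  open Inverse φ
  i : Fin _
  i = from (f x)

  placed : to i ≡ f x
  placed = strictlyInverseˡ (f x)

  preserve : ∀ {u v} → R u v → Adj G (f u) (f v)
  preserve {u} {v} = Equivalence.to (f-iso u v)

  reflect : ∀ {u v} → Adj G (f u) (f v) → R u v
  reflect {u} {v} = Equivalence.from (f-iso u v)

  inNbhd : ∀ {a} → R x a → EarlierNbhd G to i (f a)
  inNbhd {a} xa = earlier a (λ { refl → irrefl G (preserve xa) })
                , subst (λ z → Adj G z (f a)) (sym placed) (preserve xa)

  refute : Obstruction R x → ⊥
  refute (triangle a b xa xb ab) =
    proj₂ (composed i) (f a) (f b) (inNbhd xa) (inNbhd xb) (preserve ab)
  refute (split a b w xa xb x≁w w≢x aw b≁w) =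
    b≁w (reflect (Equivalence.to sameOutside (preserve aw)))
    where
    outside : ¬ EarlierNbhd G to i (f w)
    outside (_ , adj) = x≁w (reflect (subst (λ z → Adj G z (f w)) placed adj))

    sameOutside : Adj G (f a) (f w) ⇔ Adj G (f b) (f w)
    sameOutside = proj₁ (composed i) (f a) (f b) (inNbhd xa) (inNbhd xb)
                    (f w) (earlier w w≢x) outside

-- House: square 0-1-2-3 with roof 4 over the edge 0-1.  The roof triangle
-- obstructs 0, 1, 4; at 2 and 3 the roof splits the two square neighbours.
houseObstruction : ∀ x → Obstruction (SymAdj houseE) x
houseObstruction 0F = triangle 1F 4F tt tt tt
houseObstruction 1F = triangle 0F 4F tt tt tt
houseObstruction 2F = split 1F 3F 4F tt tt (λ ()) (λ ()) tt (λ ())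
houseObstruction 3F = split 0F 2F 4F tt tt (λ ()) (λ ()) tt (λ ())
houseObstruction 4F = triangle 0F 1F tt tt tt

-- Domino: two steps along the outer cycle 0-1-2-5-4-3 from x reach a vertex w
-- adjacent to the first step a but not to another neighbour b of x.
dominoObstruction : ∀ x → Obstruction (SymAdj dominoE) x
dominoObstruction 0F = split 1F 3F 2F tt tt (λ ()) (λ ()) tt (λ ())
dominoObstruction 1F = split 0F 2F 3F tt tt (λ ()) (λ ()) tt (λ ())
dominoObstruction 2F = split 1F 5F 0F tt tt (λ ()) (λ ()) tt (λ ())
dominoObstruction 3F = split 4F 0F 5F tt tt (λ ()) (λ ()) tt (λ ())
dominoObstruction 4F = split 3F 5F 0F tt tt (λ ()) (λ ()) tt (λ ())
dominoObstruction 5F = split 4F 2F 3F tt tt (λ ()) (λ ()) tt (λ ())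

-- Gem: every vertex lies in a triangle with the apex 4.
gemObstruction : ∀ x → Obstruction (SymAdj gemE) x
gemObstruction 0F = triangle 1F 4F tt tt tt
gemObstruction 1F = triangle 0F 4F tt tt tt
gemObstruction 2F = triangle 1F 4F tt tt tt
gemObstruction 3F = triangle 2F 4F tt tt tt
gemObstruction 4F = triangle 0F 1F tt tt tt

-- Adjacency of positions p, q on the cycle 0,…,m-1; CycleAdj m u v unfolds
-- to CycleAdjℕ m (toℕ u) (toℕ v).
CycleAdjℕ : ℕ → ℕ → ℕ → Set
CycleAdjℕ m p q = (suc p ≡ q) ⊎ (suc q ≡ p)
  ⊎ (p ≡ 0 × suc q ≡ m) ⊎ (q ≡ 0 × suc p ≡ m)

successorAdj : ∀ {m p} → CycleAdjℕ m p (suc p)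
successorAdj = inj₁ refl

predecessorAdj : ∀ {m q} → CycleAdjℕ m (suc q) q
predecessorAdj = inj₂ (inj₁ refl)

closingAdj : ∀ {q} → CycleAdjℕ (suc q) 0 q
closingAdj = inj₂ (inj₂ (inj₁ (refl , refl)))

closingAdj′ : ∀ {p} → CycleAdjℕ (suc p) p 0
closingAdj′ = inj₂ (inj₂ (inj₂ (refl , refl)))

nonAdjacent : ∀ {m p q} → suc p ≢ q → suc q ≢ p → (p ≡ 0 → suc q ≢ m) →
  (q ≡ 0 → suc p ≢ m) → ¬ CycleAdjℕ m p q
nonAdjacent notSucc _       _      _      (inj₁ e)                      = notSucc e
nonAdjacent _       notPred _      _      (inj₂ (inj₁ e))               = notPred e
nonAdjacent _       _       wrapPQ _      (inj₂ (inj₂ (inj₁ (p0 , e)))) = wrapPQ p0 e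
nonAdjacent _       _       _      wrapQP (inj₂ (inj₂ (inj₂ (q0 , e)))) = wrapQP q0 e

record CycleSplit (m t : ℕ) : Set where
  field
    a b w : ℕ
    a<m   : a < m
    b<m   : b < m
    w<m   : w < m
    t~a   : CycleAdjℕ m t a
    t~b   : CycleAdjℕ m t b
    t≁w   : ¬ CycleAdjℕ m t w
    w≢t   : w ≢ t
    a~w   : CycleAdjℕ m a w
    b≁w   : ¬ CycleAdjℕ m b w

-- The position t on the cycle 0,…,k+4: the first one, one whose two successors
-- exist without wrapping around, or one of the last two.
data CyclePosition (k : ℕ) : ℕ → Set where
  first       : CyclePosition k 0
  inner       : ∀ s → s ≤ suc k → CyclePosition k (suc s)
  penultimate : CyclePosition k (3 + k)
  last        : CyclePosition k (4 + k)

cyclePosition : ∀ k t → t < 5 + k → CyclePosition k t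
cyclePosition k zero    _           = first
cyclePosition k (suc s) (s<s s<4+k) with m≤n⇒m<n∨m≡n s<4+k
... | inj₂ refl = last
... | inj₁ (s<s s<3+k) with m≤n⇒m<n∨m≡n s<3+k
...   | inj₂ refl        = penultimate
...   | inj₁ (s<s (s<s s≤1+k)) = inner s s≤1+k

onCycle : ∀ {k d} → d < 5 → d + k < 5 + k
onCycle {k} = +-monoˡ-< k

-- Use the forward neighbour t+1, split from t-1 by t+2, unless t is one of the
-- last two positions; there go backwards: t-1 is split from t+1 by t-2.
cycleSplit : ∀ k t → t < 5 + k → CycleSplit (5 + k) t
cycleSplit k t t<m with cyclePosition k t t<m
... | first = record
  { a = 1 ; b = 4 + k ; w = 2
  ; a<m = s<s z<s ; b<m = n<1+n _ ; w<m = s<s (s<s z<s)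
  ; t~a = successorAdj ; t~b = closingAdj
  ; t≁w = nonAdjacent (λ ()) (λ ()) (λ _ ()) (λ ())
  ; w≢t = λ ()
  ; a~w = successorAdj
  ; b≁w = nonAdjacent (λ ()) (λ ()) (λ ()) (λ ())
  }
... | inner s s≤1+k = record
  { a = 2 + s ; b = s ; w = 3 + s
  ; a<m = ≤-<-trans (n≤1+n _) w<m ; b<m = ≤-<-trans (m≤n+m s 3) w<m ; w<m = w<m
  ; t~a = successorAdj ; t~b = predecessorAdj
  ; t≁w = nonAdjacent (λ ()) (λ ()) (λ ()) (λ ())
  ; w≢t = λ ()
  ; a~w = successorAdj
  ; b≁w = nonAdjacent (λ ()) (λ ()) (λ { refl () }) (λ ())
  }
  where
  w<m : 3 + s < 5 + k
  w<m = s<s (s<s (s<s (s<s s≤1+k)))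
... | penultimate = record
  { a = 2 + k ; b = 4 + k ; w = 1 + k
  ; a<m = onCycle (s<s (s<s z<s)) ; b<m = onCycle (s<s (s<s (s<s (s<s z<s))))
  ; w<m = onCycle (s<s z<s)
  ; t~a = predecessorAdj ; t~b = successorAdj
  ; t≁w = nonAdjacent (λ ()) (λ ()) (λ ()) (λ ())
  ; w≢t = λ ()
  ; a~w = predecessorAdj
  ; b≁w = nonAdjacent (λ ()) (λ ()) (λ ()) (λ ())
  }
... | last = record
  { a = 3 + k ; b = 0 ; w = 2 + k
  ; a<m = onCycle (s<s (s<s (s<s z<s))) ; b<m = z<s ; w<m = onCycle (s<s (s<s z<s))
  ; t~a = predecessorAdj ; t~b = closingAdj′
  ; t≁w = nonAdjacent (λ ()) (λ ()) (λ ()) (λ ())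
  ; w≢t = λ ()
  ; a~w = predecessorAdj
  ; b≁w = nonAdjacent (λ ()) (λ ()) (λ _ ()) (λ ())
  }

toPositions : ∀ {m p q} {u v : Fin m} → toℕ u ≡ p → toℕ v ≡ q →
  CycleAdj m u v → CycleAdjℕ m p q
toPositions refl refl uv = uv

fromPositions : ∀ {m p q} {u v : Fin m} → toℕ u ≡ p → toℕ v ≡ q →
  CycleAdjℕ m p q → CycleAdj m u v
fromPositions refl refl pq = pq

splitObstruction : ∀ {m} (x : Fin m) → CycleSplit m (toℕ x) → Obstruction (CycleAdj m) x
splitObstruction x s = split (fromℕ< a<m) (fromℕ< b<m) (fromℕ< w<m)
  (fromPositions refl atA t~a) (fromPositions refl atB t~b)
  (λ xw → t≁w (toPositions refl atW xw))
  (λ w≡x → w≢t (trans (sym atW) (cong toℕ w≡x)))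
  (fromPositions atA atW a~w)
  (λ bw → b≁w (toPositions atB atW bw))
  where
  open CycleSplit s
  atA = toℕ-fromℕ< a<m
  atB = toℕ-fromℕ< b<m
  atW = toℕ-fromℕ< w<m

cycleObstruction : ∀ {m} → 5 ≤ m → ∀ x → Obstruction (CycleAdj m) x
cycleObstruction (s≤s (s≤s (s≤s (s≤s (s≤s {n = k} _))))) x =
  splitObstruction x (cycleSplit k (toℕ x) (toℕ<n x))

lemma6 : ∀ (n : ℕ) (G : Graph n) → IndependentModuleComposed G → HHDGFree G
lemma6 n G composed =
    excluded houseObstruction
  , (λ { m 5≤m@(s≤s _) → excluded (cycleObstruction 5≤m) })
  , excluded dominoObstruction
  , excluded gemObstruction
  where
  excluded : ∀ {k} {R : Fin (suc k) → Fin (suc k) → Set} →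
    (∀ x → Obstruction R x) → ¬ HasInduced (suc k) R G
  excluded = obstructedPatternsExcluded G composed _
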